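{- Let $G$ be a finite simple undirected graph and let $\mathcal{K}=\{C_1,\dots,C_n\}$ be a collection of pairwise independent cliques of $G$. If $x^{\mathcal{K}}(\delta)$ is an independent clique solution of $\mathrm{LCP}_\delta(G)$ for some $\delta>0$, then for every $\delta'\in[\delta,1)$ there exists an independent clique solution of $\mathrm{LCP}_{\delta'}(G)$ with support $\bigcup_{j}C_j$.
   Context: For a graph $G$ with adjacency matrix $A$ and $\delta>0$, $\mathrm{LCP}_\delta(G)$ is the problem: find $x\in\mathbb{R}^{V(G)}$ with $x\ge0$, $(I+\delta A)x-\mathbf{e}\ge 0$, $x^\top((I+\delta A)x-\mathbf{e})=0$ ($\mathbf{e}$ the all-ones vector). Two cliques are independent if no vertex of one is adjacent to any vertex of the other. An independent clique solution (ICS) is a solution whose support $\{i:x_i>0\}$ is a union of pairwise independent cliques. For a collection $\mathcal{K}$ of pairwise independent cliques, $x^{\mathcal{K}}(\delta)\in\mathbb{R}^{V(G)}$ is defined by $x^{\mathcal{K}}_i(\delta)=\frac{1}{1+(|C_j|-1)\delta}$ if $i\in C_j\in\mathcal{K}$, and $x^{\mathcal{K}}_i(\delta)=0$ otherwise. -}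

module Defs where

open import Level using (Level; _⊔_; suc)
open import Data.Bool using (Bool; true; false; if_then_else_)
open import Data.Nat as ℕ using (ℕ; _∸_)
open import Data.Fin using (Fin) renaming (zero to fz; suc to fs)
open import Data.Fin.Subset using (Subset; _∈_; ∣_∣)
open import Data.Vec using (lookup)
open import Data.List using (List; []; _∷_)
open import Data.List.Relation.Unary.Any using (Any)
open import Data.List.Relation.Unary.All using (All)
open import Data.List.Relation.Unary.AllPairs using (AllPairs)
open import Data.Product using (_×_; Σ; ∃)
open import Data.Empty using (⊥)
open import Relation.Nullary using (¬_)
open import Relation.Binary.PropositionalEquality using (_≡_; _≢_)
open import Relation.Binary.Structures using (IsTotalOrder)
open import Algebra.Structures using (IsCommutativeRing)
open import Function.Bundles using (_⇔_)

-- Ordered fields (the paper works over ℝ; ℝ is an instance of this record).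
-- The multiplicative inverse is total with the convention 0⁻¹ = 0.

record OrderedField (c ℓ₁ ℓ₂ : Level) : Set (Level.suc (c ⊔ ℓ₁ ⊔ ℓ₂)) where
  infixl 7 _*_
  infixl 6 _+_ _-_
  infix  4 _≈_ _≤_ _<_
  infix  8 _⁻¹
  field
    Carrier : Set c
    _≈_     : Carrier → Carrier → Set ℓ₁
    _≤_     : Carrier → Carrier → Set ℓ₂
    _+_     : Carrier → Carrier → Carrier
    _*_     : Carrier → Carrier → Carrier
    -_      : Carrier → Carrier
    0#      : Carrier
    1#      : Carrier
    _⁻¹     : Carrier → Carrier
    isCommutativeRing : IsCommutativeRing _≈_ _+_ _*_ -_ 0# 1#
    isTotalOrder      : IsTotalOrder _≈_ _≤_
    0≉1               : ¬ (0# ≈ 1#)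
    +-monoˡ-≤         : ∀ {x y} z → x ≤ y → x + z ≤ y + z
    *-nonneg          : ∀ {x y} → 0# ≤ x → 0# ≤ y → 0# ≤ x * y
    ⁻¹-inverse        : ∀ {x} → ¬ (x ≈ 0#) → x * x ⁻¹ ≈ 1#
    ⁻¹-zero           : 0# ⁻¹ ≈ 0#
    ⁻¹-cong           : ∀ {x y} → x ≈ y → x ⁻¹ ≈ y ⁻¹

  _-_ : Carrier → Carrier → Carrier
  x - y = x + (- y)

  _<_ : Carrier → Carrier → Set (ℓ₁ ⊔ ℓ₂)
  x < y = (x ≤ y) × ¬ (x ≈ y)

  fromℕ : ℕ → Carrier
  fromℕ ℕ.zero    = 0#
  fromℕ (ℕ.suc n) = 1# + fromℕ n

record Graph (N : ℕ) : Set where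
  field
    adj     : Fin N → Fin N → Bool
    adj-sym : ∀ i j → adj i j ≡ adj j i
    irrefl  : ∀ i → adj i i ≡ false

open Graph public

module _ {N : ℕ} (G : Graph N) where

  IsClique : Subset N → Set
  IsClique C = ∀ i j → i ∈ C → j ∈ C → i ≢ j → adj G i j ≡ true

  Independent : Subset N → Subset N → Set
  Independent C D = ∀ i j → i ∈ C → j ∈ D → adj G i j ≡ false

  -- two distinct members of a collection: disjoint (automatic for distinct
  -- independent cliques) and independent
  DistinctIndependent : Subset N → Subset N → Set
  DistinctIndependent C D = (∀ i → i ∈ C → i ∈ D → ⊥) × Independent C D

  PairwiseIndependentCliques : List (Subset N) → Set
  PairwiseIndependentCliques Ks =
    All IsClique Ks × AllPairs DistinctIndependent Ks

module _ {c ℓ₁ ℓ₂} (F : OrderedField c ℓ₁ ℓ₂) where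
  open OrderedField F

  sumF : ∀ {n} → (Fin n → Carrier) → Carrier
  sumF {ℕ.zero}  f = 0#
  sumF {ℕ.suc n} f = f fz + sumF (λ i → f (fs i))

  module _ {N : ℕ} (G : Graph N) where

    A : Fin N → Fin N → Carrier
    A i j = if adj G i j then 1# else 0#

    lcpW : Carrier → (Fin N → Carrier) → Fin N → Carrier
    lcpW δ x i = (x i + δ * sumF (λ j → A i j * x j)) - 1#

    SolvesLCP : Carrier → (Fin N → Carrier) → Set (ℓ₁ ⊔ ℓ₂)
    SolvesLCP δ x =
      (∀ i → 0# ≤ x i) × (∀ i → 0# ≤ lcpW δ x i)
      × (sumF (λ i → x i * lcpW δ x i) ≈ 0#)

    SupportIsUnion : (Fin N → Carrier) → List (Subset N) → Set (ℓ₁ ⊔ ℓ₂)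
    SupportIsUnion x Ks = ∀ i → (0# < x i) ⇔ Any (λ C → i ∈ C) Ks

    IsICS : Carrier → (Fin N → Carrier) → Set (ℓ₁ ⊔ ℓ₂)
    IsICS δ x = SolvesLCP δ x ×
      Σ (List (Subset N)) (λ Ks → PairwiseIndependentCliques G Ks × SupportIsUnion x Ks)

    xK : Carrier → List (Subset N) → Fin N → Carrier
    xK δ []       i = 0#
    xK δ (C ∷ Ks) i =
      if lookup C i then (1# + fromℕ (∣ C ∣ ∸ 1) * δ) ⁻¹ else xK δ Ks i

module Submission where

-- On a clique C ∈ 𝒦 of size k every coordinate of x^𝒦(δ) equals 1/(1+(k−1)δ),
-- and independence hides all other cliques from a vertex i ∈ C, so row i of
-- (I+δA)x^𝒦(δ) is (1+(k−1)δ)/(1+(k−1)δ) = 1 for every δ ≥ 0: complementarity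
-- holds on the support whatever δ is. Off the support x_i = 0 and the slack is
-- δ Σ_{j∼i} x_j(δ) − 1, which only grows with δ because δ/(1+(k−1)δ) is
-- increasing; so the slack at δ′ ≥ δ dominates the nonnegative slack at δ.

open import Defs
open import Algebra using (CommutativeRing)
open import Algebra.Structures using (IsCommutativeRing)
open import Data.Bool using (true; false; if_then_else_)
open import Data.Empty using (⊥-elim)
open import Data.Fin using (Fin; zero; suc)
open import Data.Fin.Properties using (_≟_)
open import Data.Fin.Subset using (Subset; _∈_; _∉_; ∣_∣; _─_; ⁅_⁆; inside; outside)
open import Data.Fin.Subset.Properties
  using (_∈?_; p─⊥≡p; p─q⊆p; x∈p∧x≢y⇒x∈p-y; x∈p⇒∣p-x∣<∣p∣)
open import Data.List using (List; []; _∷_)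
open import Data.List.Membership.Propositional using (find) renaming (_∈_ to _∈ₗ_)
open import Data.List.Relation.Unary.Any using (Any; here; there; any?)
import Data.List.Relation.Unary.All as All
open import Data.List.Relation.Unary.AllPairs using (AllPairs; _∷_)
open import Data.Nat as ℕ using (ℕ; _∸_; s≤s; z≤n)
import Data.Nat.Properties as ℕ
open import Data.Product using (Σ; _×_; _,_; proj₁; proj₂)
open import Data.Sum using (_⊎_; inj₁; inj₂)
open import Data.Vec using (lookup; []; _∷_; here; there)
open import Data.Vec.Properties using ([]=⇒lookup; lookup⇒[]=)
open import Function using (_∘_; case_of_)
open import Function.Bundles using (mk⇔)
open import Relation.Binary.Bundles using (Poset)
import Relation.Binary.Reasoning.PartialOrder as PosetReasoning
open import Relation.Binary.Structures using (IsTotalOrder)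
open import Relation.Binary.PropositionalEquality as ≡ using (_≡_)
open import Relation.Nullary using (¬_; Dec; yes; no)

∣p─⁅x⁆∣≡∣p∣∸1 : ∀ {n} {p : Subset n} {x} → x ∈ p → ∣ p ─ ⁅ x ⁆ ∣ ≡ ∣ p ∣ ∸ 1
∣p─⁅x⁆∣≡∣p∣∸1 {p = inside ∷ p} here = ≡.cong ∣_∣ (p─⊥≡p p)
∣p─⁅x⁆∣≡∣p∣∸1 {p = inside ∷ p} (there x∈p) =
  ≡.trans (≡.cong ℕ.suc (∣p─⁅x⁆∣≡∣p∣∸1 x∈p))
          (ℕ.m+[n∸m]≡n (ℕ.≤-trans (s≤s z≤n) (x∈p⇒∣p-x∣<∣p∣ x∈p)))
∣p─⁅x⁆∣≡∣p∣∸1 {p = outside ∷ p} (there x∈p) = ∣p─⁅x⁆∣≡∣p∣∸1 x∈p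

x∉p─⁅x⁆ : ∀ {n} (p : Subset n) x → x ∉ p ─ ⁅ x ⁆
x∉p─⁅x⁆ (inside  ∷ p) zero    ()
x∉p─⁅x⁆ (outside ∷ p) zero    ()
x∉p─⁅x⁆ (inside  ∷ p) (suc x) (there x∈p─⁅x⁆) = x∉p─⁅x⁆ p x x∈p─⁅x⁆
x∉p─⁅x⁆ (outside ∷ p) (suc x) (there x∈p─⁅x⁆) = x∉p─⁅x⁆ p x x∈p─⁅x⁆

AllPairs-lookup₂ : ∀ {a r} {A : Set a} {R : A → A → Set r} {xs : List A} {x y} →
                   AllPairs R xs → x ∈ₗ xs → y ∈ₗ xs → x ≡ y ⊎ R x y ⊎ R y x
AllPairs-lookup₂ _        (here ≡.refl) (here ≡.refl) = inj₁ ≡.refl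
AllPairs-lookup₂ (Rx ∷ _) (here ≡.refl) (there y∈xs)  = inj₂ (inj₁ (All.lookup Rx y∈xs))
AllPairs-lookup₂ (Rx ∷ _) (there x∈xs)  (here ≡.refl) = inj₂ (inj₂ (All.lookup Rx x∈xs))
AllPairs-lookup₂ (_ ∷ Rs) (there x∈xs)  (there y∈xs)  = AllPairs-lookup₂ Rs x∈xs y∈xs

module _ {c ℓ₁ ℓ₂} (F : OrderedField c ℓ₁ ℓ₂) where
  open OrderedField F
  open IsCommutativeRing isCommutativeRing
    using (refl; sym; trans; reflexive; +-cong; *-cong; +-comm; +-assoc; *-comm;
           +-identityˡ; +-identityʳ; *-identityˡ; *-identityʳ; -‿inverseˡ; -‿inverseʳ;
           zeroˡ; zeroʳ; distribˡ; distribʳ; -‿cong)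
  open IsTotalOrder isTotalOrder using (total; antisym; isPartialOrder; ≤-respˡ-≈; ≤-respʳ-≈)
    renaming (refl to ≤-refl; trans to ≤-trans; reflexive to ≤-reflexive)

  commutativeRing : CommutativeRing c ℓ₁
  commutativeRing = record { isCommutativeRing = isCommutativeRing }

  poset : Poset c ℓ₁ ℓ₂
  poset = record { isPartialOrder = isPartialOrder }

  open CommutativeRing commutativeRing using (ring; *-commutativeSemigroup)
  open import Algebra.Properties.Ring ring using (-‿distribˡ-*; -1*x≈-x; -‿involutive)
  open import Algebra.Properties.CommutativeSemigroup *-commutativeSemigroup
    using (interchange; x∙yz≈y∙xz; x∙yz≈zx∙y)
  open PosetReasoning poset

  +-monoʳ-≤ : ∀ z {x y} → x ≤ y → z + x ≤ z + y
  +-monoʳ-≤ z {x} {y} x≤y = begin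
    z + x ≈⟨ +-comm z x ⟩
    x + z ≤⟨ +-monoˡ-≤ z x≤y ⟩
    y + z ≈⟨ +-comm y z ⟩
    z + y ∎

  +-mono-≤ : ∀ {x y u v} → x ≤ y → u ≤ v → x + u ≤ y + v
  +-mono-≤ {y = y} {u} x≤y u≤v = ≤-trans (+-monoˡ-≤ u x≤y) (+-monoʳ-≤ y u≤v)

  x≤y⇒0≤y-x : ∀ {x y} → x ≤ y → 0# ≤ y - x
  x≤y⇒0≤y-x {x} {y} x≤y = begin
    0#      ≈⟨ sym (-‿inverseʳ x) ⟩
    x - x   ≤⟨ +-monoˡ-≤ (- x) x≤y ⟩
    y - x   ∎

  0≤-x⇒x≤0 : ∀ {x} → 0# ≤ - x → x ≤ 0#
  0≤-x⇒x≤0 {x} 0≤-x = begin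
    x          ≈⟨ sym (+-identityˡ x) ⟩
    0# + x     ≤⟨ +-monoˡ-≤ x 0≤-x ⟩
    - x + x    ≈⟨ -‿inverseˡ x ⟩
    0#         ∎

  *-monoˡ-≤-nonneg : ∀ {z} → 0# ≤ z → ∀ {x y} → x ≤ y → x * z ≤ y * z
  *-monoˡ-≤-nonneg {z} 0≤z {x} {y} x≤y = begin
    x * z                 ≈⟨ sym (+-identityˡ (x * z)) ⟩
    0# + x * z            ≤⟨ +-monoˡ-≤ (x * z) (*-nonneg (x≤y⇒0≤y-x x≤y) 0≤z) ⟩
    (y - x) * z + x * z   ≈⟨ sym (distribʳ z (y - x) x) ⟩
    (y - x + x) * z       ≈⟨ *-cong (trans (+-assoc y (- x) x)
                                        (trans (+-cong refl (-‿inverseˡ x)) (+-identityʳ y))) refl ⟩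
    y * z                 ∎

  *-monoʳ-≤-nonneg : ∀ {z} → 0# ≤ z → ∀ {x y} → x ≤ y → z * x ≤ z * y
  *-monoʳ-≤-nonneg {z} 0≤z {x} {y} x≤y =
    ≤-respˡ-≈ (*-comm x z) (≤-respʳ-≈ (*-comm y z) (*-monoˡ-≤-nonneg 0≤z x≤y))

  0≤1 : 0# ≤ 1#
  0≤1 with total 0# 1#
  ... | inj₁ 0≤1 = 0≤1
  ... | inj₂ 1≤0 = begin
    0#            ≤⟨ *-nonneg 0≤-1 0≤-1 ⟩
    - 1# * - 1#   ≈⟨ -1*x≈-x (- 1#) ⟩
    - - 1#        ≈⟨ -‿involutive 1# ⟩
    1#            ∎
    where
    0≤-1 : 0# ≤ - 1#
    0≤-1 = ≤-respʳ-≈ (+-identityˡ (- 1#)) (x≤y⇒0≤y-x 1≤0)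

  0<1 : 0# < 1#
  0<1 = 0≤1 , 0≉1

  <-≤-trans : ∀ {x y z} → x < y → y ≤ z → x < z
  <-≤-trans (x≤y , x≉y) y≤z =
    ≤-trans x≤y y≤z , λ x≈z → x≉y (antisym x≤y (≤-respʳ-≈ (sym x≈z) y≤z))

  0≤x⇒1≤1+x : ∀ {x} → 0# ≤ x → 1# ≤ 1# + x
  0≤x⇒1≤1+x {x} 0≤x = ≤-respˡ-≈ (+-identityʳ 1#) (+-monoʳ-≤ 1# 0≤x)

  0≤x⇒0<1+x : ∀ {x} → 0# ≤ x → 0# < 1# + x
  0≤x⇒0<1+x 0≤x = <-≤-trans 0<1 (0≤x⇒1≤1+x 0≤x)

  0≤fromℕ : ∀ n → 0# ≤ fromℕ n
  0≤fromℕ ℕ.zero    = ≤-refl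
  0≤fromℕ (ℕ.suc n) = ≤-trans 0≤1 (0≤x⇒1≤1+x (0≤fromℕ n))

  x*x⁻¹≈1 : ∀ {x} → 0# < x → x * x ⁻¹ ≈ 1#
  x*x⁻¹≈1 (_ , 0≉x) = ⁻¹-inverse (0≉x ∘ sym)

  0<x⇒0<x⁻¹ : ∀ {x} → 0# < x → 0# < x ⁻¹
  0<x⇒0<x⁻¹ {x} 0<x = 0≤x⁻¹ , λ 0≈x⁻¹ → 0≉1 (begin-equality
    0#         ≈⟨ sym (zeroʳ x) ⟩
    x * 0#     ≈⟨ *-cong refl 0≈x⁻¹ ⟩
    x * x ⁻¹   ≈⟨ x*x⁻¹≈1 0<x ⟩
    1#         ∎)
    where
    0≤x⁻¹ : 0# ≤ x ⁻¹
    0≤x⁻¹ with total 0# (x ⁻¹)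
    ... | inj₁ 0≤x⁻¹ = 0≤x⁻¹
    ... | inj₂ x⁻¹≤0 = ⊥-elim (proj₂ 0<1 (antisym 0≤1 (0≤-x⇒x≤0 (begin
      0#            ≤⟨ *-nonneg (≤-respʳ-≈ (+-identityˡ _) (x≤y⇒0≤y-x x⁻¹≤0)) (proj₁ 0<x) ⟩
      - (x ⁻¹) * x  ≈⟨ sym (-‿distribˡ-* (x ⁻¹) x) ⟩
      - (x ⁻¹ * x)  ≈⟨ -‿cong (trans (*-comm (x ⁻¹) x) (x*x⁻¹≈1 0<x)) ⟩
      - 1#          ∎))))

  x*[1+ty]≈x+t[xy] : ∀ x t y → x * (1# + t * y) ≈ x + t * (x * y)
  x*[1+ty]≈x+t[xy] x t y =
    trans (distribˡ x 1# (t * y)) (+-cong (*-identityʳ x) (x∙yz≈y∙xz x t y))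

  x/[1+tx]-mono : ∀ {t x y} → 0# ≤ t → 0# ≤ x → x ≤ y →
                  x * (1# + t * x) ⁻¹ ≤ y * (1# + t * y) ⁻¹
  x/[1+tx]-mono {t} {x} {y} 0≤t 0≤x x≤y = begin
    x * p ⁻¹                     ≈⟨ sym (trans (*-cong refl (x*x⁻¹≈1 0<q)) (*-identityʳ _)) ⟩
    (x * p ⁻¹) * (q * q ⁻¹)      ≈⟨ interchange x (p ⁻¹) q (q ⁻¹) ⟩
    (x * q) * (p ⁻¹ * q ⁻¹)      ≤⟨ *-monoˡ-≤-nonneg 0≤p⁻¹q⁻¹ xq≤yp ⟩
    (y * p) * (p ⁻¹ * q ⁻¹)      ≈⟨ *-cong refl (*-comm (p ⁻¹) (q ⁻¹)) ⟩
    (y * p) * (q ⁻¹ * p ⁻¹)      ≈⟨ interchange y p (q ⁻¹) (p ⁻¹) ⟩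
    (y * q ⁻¹) * (p * p ⁻¹)      ≈⟨ trans (*-cong refl (x*x⁻¹≈1 0<p)) (*-identityʳ _) ⟩
    y * q ⁻¹                     ∎
    where
    p q : Carrier
    p = 1# + t * x
    q = 1# + t * y
    0<p : 0# < p
    0<p = 0≤x⇒0<1+x (*-nonneg 0≤t 0≤x)
    0<q : 0# < q
    0<q = 0≤x⇒0<1+x (*-nonneg 0≤t (≤-trans 0≤x x≤y))
    0≤p⁻¹q⁻¹ : 0# ≤ p ⁻¹ * q ⁻¹
    0≤p⁻¹q⁻¹ = *-nonneg (proj₁ (0<x⇒0<x⁻¹ 0<p)) (proj₁ (0<x⇒0<x⁻¹ 0<q))
    xq≤yp : x * q ≤ y * p
    xq≤yp = begin
      x * q             ≈⟨ x*[1+ty]≈x+t[xy] x t y ⟩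
      x + t * (x * y)   ≤⟨ +-monoˡ-≤ (t * (x * y)) x≤y ⟩
      y + t * (x * y)   ≈⟨ +-cong refl (*-cong refl (*-comm x y)) ⟩
      y + t * (y * x)   ≈⟨ sym (x*[1+ty]≈x+t[xy] y t x) ⟩
      y * p             ∎

  x≈0⇒x*y≈0 : ∀ {x y} → x ≈ 0# → x * y ≈ 0#
  x≈0⇒x*y≈0 {y = y} x≈0 = trans (*-cong x≈0 refl) (zeroˡ y)

  y≈0⇒x*y≈0 : ∀ {x y} → y ≈ 0# → x * y ≈ 0#
  y≈0⇒x*y≈0 {x} y≈0 = trans (*-cong refl y≈0) (zeroʳ x)

  sumF-cong : ∀ {n} {f g : Fin n → Carrier} → (∀ i → f i ≈ g i) → sumF F f ≈ sumF F g
  sumF-cong {ℕ.zero}  f≈g = refl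
  sumF-cong {ℕ.suc n} f≈g = +-cong (f≈g zero) (sumF-cong (f≈g ∘ suc))

  sumF-mono-≤ : ∀ {n} {f g : Fin n → Carrier} → (∀ i → f i ≤ g i) → sumF F f ≤ sumF F g
  sumF-mono-≤ {ℕ.zero}  f≤g = ≤-refl
  sumF-mono-≤ {ℕ.suc n} f≤g = +-mono-≤ (f≤g zero) (sumF-mono-≤ (f≤g ∘ suc))

  *-distribˡ-sumF : ∀ {n} k (f : Fin n → Carrier) → k * sumF F f ≈ sumF F (λ i → k * f i)
  *-distribˡ-sumF {ℕ.zero}  k f = zeroʳ k
  *-distribˡ-sumF {ℕ.suc n} k f = trans (distribˡ k _ _) (+-cong refl (*-distribˡ-sumF k (f ∘ suc)))

  sumF-≈0 : ∀ {n} {f : Fin n → Carrier} → (∀ i → f i ≈ 0#) → sumF F f ≈ 0#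
  sumF-≈0 {ℕ.zero}  f≈0 = refl
  sumF-≈0 {ℕ.suc n} f≈0 = trans (+-cong (f≈0 zero) (sumF-≈0 (f≈0 ∘ suc))) (+-identityˡ 0#)

  𝟙 : ∀ {n} → Subset n → Fin n → Carrier
  𝟙 p i = if lookup p i then 1# else 0#

  sumF-𝟙 : ∀ {n} (p : Subset n) → sumF F (𝟙 p) ≈ fromℕ ∣ p ∣
  sumF-𝟙 []            = refl
  sumF-𝟙 (inside  ∷ p) = +-cong refl (sumF-𝟙 p)
  sumF-𝟙 (outside ∷ p) = trans (+-identityˡ _) (sumF-𝟙 p)

  𝟙-∈ : ∀ {n} {p : Subset n} {i} → i ∈ p → 𝟙 p i ≡ 1#
  𝟙-∈ i∈p = ≡.cong (if_then 1# else 0#) ([]=⇒lookup i∈p)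

  𝟙-∉ : ∀ {n} {p : Subset n} {i} → i ∉ p → 𝟙 p i ≡ 0#
  𝟙-∉ {p = p} {i} i∉p with lookup p i in i∈p
  ... | true  = ⊥-elim (i∉p (lookup⇒[]= i p i∈p))
  ... | false = ≡.refl

  module _ {N : ℕ} (G : Graph N) where

    A≡1 : ∀ {i j} → adj G i j ≡ true → A F G i j ≡ 1#
    A≡1 = ≡.cong (if_then 1# else 0#)

    A≡0 : ∀ {i j} → adj G i j ≡ false → A F G i j ≡ 0#
    A≡0 = ≡.cong (if_then 1# else 0#)

    0≤A : ∀ i j → 0# ≤ A F G i j
    0≤A i j with adj G i j
    ... | true  = 0≤1
    ... | false = ≤-refl

    cliqueWeight : Carrier → Subset N → Carrier
    cliqueWeight δ C = (1# + fromℕ (∣ C ∣ ∸ 1) * δ) ⁻¹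

    0<cliqueWeight : ∀ {δ} → 0# ≤ δ → ∀ C → 0# < cliqueWeight δ C
    0<cliqueWeight 0≤δ C = 0<x⇒0<x⁻¹ (0≤x⇒0<1+x (*-nonneg (0≤fromℕ (∣ C ∣ ∸ 1)) 0≤δ))

    xK-∈ : ∀ {δ C Ks i} → AllPairs (DistinctIndependent G) Ks → C ∈ₗ Ks → i ∈ C →
           xK F G δ Ks i ≡ cliqueWeight δ C
    xK-∈ {δ} {C} {_ ∷ Ks} {i} _ (here ≡.refl) i∈C =
      ≡.cong (if_then cliqueWeight δ C else xK F G δ Ks i) ([]=⇒lookup i∈C)
    xK-∈ {Ks = D ∷ _} {i} (D#Ks ∷ Ks-DI) (there C∈Ks) i∈C with lookup D i in i∈D
    ... | true  = ⊥-elim (proj₁ (All.lookup D#Ks C∈Ks) i (lookup⇒[]= i D i∈D) i∈C)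
    ... | false = xK-∈ Ks-DI C∈Ks i∈C

    xK-∉ : ∀ {δ} Ks {i} → ¬ Any (i ∈_) Ks → xK F G δ Ks i ≡ 0#
    xK-∉ []       i∉⋃ = ≡.refl
    xK-∉ (C ∷ Ks) {i} i∉⋃ with lookup C i in i∈C
    ... | true  = ⊥-elim (i∉⋃ (here (lookup⇒[]= i C i∈C)))
    ... | false = xK-∉ Ks (i∉⋃ ∘ there)

    0≤xK : ∀ {δ} → 0# ≤ δ → ∀ Ks i → 0# ≤ xK F G δ Ks i
    0≤xK 0≤δ []       i = ≤-refl
    0≤xK 0≤δ (C ∷ Ks) i with lookup C i
    ... | true  = proj₁ (0<cliqueWeight 0≤δ C)
    ... | false = 0≤xK 0≤δ Ks i

    δ*xK-mono : ∀ {δ δ′} → 0# ≤ δ → δ ≤ δ′ → ∀ Ks i → δ * xK F G δ Ks i ≤ δ′ * xK F G δ′ Ks i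
    δ*xK-mono {δ} {δ′} 0≤δ δ≤δ′ []       i =
      ≤-respˡ-≈ (sym (zeroʳ δ)) (≤-respʳ-≈ (sym (zeroʳ δ′)) ≤-refl)
    δ*xK-mono          0≤δ δ≤δ′ (C ∷ Ks) i with lookup C i
    ... | true  = x/[1+tx]-mono (0≤fromℕ (∣ C ∣ ∸ 1)) 0≤δ δ≤δ′
    ... | false = δ*xK-mono 0≤δ δ≤δ′ Ks i

    AxK : Carrier → List (Subset N) → Fin N → Carrier
    AxK δ Ks i = sumF F (λ j → A F G i j * xK F G δ Ks j)

    covered? : ∀ (Ks : List (Subset N)) i → Dec (Any (i ∈_) Ks)
    covered? Ks i = any? (i ∈?_) Ks

    module _ {Ks} (Ks-ind : PairwiseIndependentCliques G Ks)
             {C} (C∈Ks : C ∈ₗ Ks) {i} (i∈C : i ∈ C) where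

      neighbour∉C⇒uncovered : ∀ {j} → adj G i j ≡ true → j ∉ C → ¬ Any (j ∈_) Ks
      neighbour∉C⇒uncovered {j} i~j j∉C j∈⋃ with find j∈⋃
      ... | D , D∈Ks , j∈D with AllPairs-lookup₂ (proj₂ Ks-ind) C∈Ks D∈Ks
      ...   | inj₁ ≡.refl        = j∉C j∈D
      ...   | inj₂ (inj₁ C#D)    = case ≡.trans (≡.sym i~j) (proj₂ C#D i j i∈C j∈D) of λ ()
      ...   | inj₂ (inj₂ D#C)    =
        case ≡.trans (≡.sym i~j) (≡.trans (adj-sym G i j) (proj₂ D#C j i j∈D i∈C)) of λ ()

      A*xK≈cliqueWeight*𝟙[C─i] : ∀ δ j →
                                 A F G i j * xK F G δ Ks j ≈ cliqueWeight δ C * 𝟙 (C ─ ⁅ i ⁆) j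
      A*xK≈cliqueWeight*𝟙[C─i] δ j with j ≟ i
      ... | yes ≡.refl = trans (x≈0⇒x*y≈0 (reflexive (A≡0 (irrefl G i))))
                               (sym (y≈0⇒x*y≈0 (reflexive (𝟙-∉ (x∉p─⁅x⁆ C i)))))
      ... | no j≢i with j ∈? C
      ...   | yes j∈C = begin-equality
        A F G i j * xK F G δ Ks j
          ≈⟨ *-cong (reflexive (A≡1 i~j)) (reflexive (xK-∈ (proj₂ Ks-ind) C∈Ks j∈C)) ⟩
        1# * cliqueWeight δ C
          ≈⟨ *-comm 1# _ ⟩
        cliqueWeight δ C * 1#
          ≈⟨ *-cong refl (reflexive (≡.sym (𝟙-∈ (x∈p∧x≢y⇒x∈p-y j∈C j≢i)))) ⟩
        cliqueWeight δ C * 𝟙 (C ─ ⁅ i ⁆) j ∎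
        where
        i~j : adj G i j ≡ true
        i~j = All.lookup (proj₁ Ks-ind) C∈Ks i j i∈C j∈C (j≢i ∘ ≡.sym)
      ...   | no j∉C = trans A*xK≈0 (sym (y≈0⇒x*y≈0 (reflexive (𝟙-∉ (j∉C ∘ p─q⊆p C ⁅ i ⁆)))))
        where
        A*xK≈0 : A F G i j * xK F G δ Ks j ≈ 0#
        A*xK≈0 with adj G i j in i~j
        ... | true  = y≈0⇒x*y≈0 (reflexive (xK-∉ Ks (neighbour∉C⇒uncovered i~j j∉C)))
        ... | false = zeroˡ _

      AxK≈cliqueWeight*[∣C∣∸1] : ∀ δ → AxK δ Ks i ≈ cliqueWeight δ C * fromℕ (∣ C ∣ ∸ 1)
      AxK≈cliqueWeight*[∣C∣∸1] δ = begin-equality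
        AxK δ Ks i                          ≈⟨ sumF-cong (A*xK≈cliqueWeight*𝟙[C─i] δ) ⟩
        sumF F (λ j → w * 𝟙 (C ─ ⁅ i ⁆) j)  ≈⟨ sym (*-distribˡ-sumF w (𝟙 (C ─ ⁅ i ⁆))) ⟩
        w * sumF F (𝟙 (C ─ ⁅ i ⁆))          ≈⟨ *-cong refl (sumF-𝟙 (C ─ ⁅ i ⁆)) ⟩
        w * fromℕ ∣ C ─ ⁅ i ⁆ ∣             ≈⟨ *-cong refl (reflexive (≡.cong fromℕ (∣p─⁅x⁆∣≡∣p∣∸1 i∈C))) ⟩
        w * fromℕ (∣ C ∣ ∸ 1)               ∎
        where
        w : Carrier
        w = cliqueWeight δ C

      lcpW-xK≈0-on-clique : ∀ {δ} → 0# ≤ δ → lcpW F G δ (xK F G δ Ks) i ≈ 0#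
      lcpW-xK≈0-on-clique {δ} 0≤δ = trans (+-cong (begin-equality
        xK F G δ Ks i + δ * AxK δ Ks i
          ≈⟨ +-cong (reflexive (xK-∈ (proj₂ Ks-ind) C∈Ks i∈C))
                    (*-cong refl (AxK≈cliqueWeight*[∣C∣∸1] δ)) ⟩
        w + δ * (w * t)        ≈⟨ +-cong (sym (*-identityˡ w)) (x∙yz≈zx∙y δ w t) ⟩
        1# * w + (t * δ) * w   ≈⟨ sym (distribʳ w 1# (t * δ)) ⟩
        (1# + t * δ) * w       ≈⟨ x*x⁻¹≈1 (0≤x⇒0<1+x (*-nonneg (0≤fromℕ (∣ C ∣ ∸ 1)) 0≤δ)) ⟩
        1#                     ∎) refl) (-‿inverseʳ 1#)
        where
        w t : Carrier
        w = cliqueWeight δ C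
        t = fromℕ (∣ C ∣ ∸ 1)

    lcpW-xK≈0-on-support : ∀ {Ks} → PairwiseIndependentCliques G Ks → ∀ {δ} → 0# ≤ δ →
                           ∀ {i} → Any (i ∈_) Ks → lcpW F G δ (xK F G δ Ks) i ≈ 0#
    lcpW-xK≈0-on-support Ks-ind 0≤δ i∈⋃ =
      let _ , C∈Ks , i∈C = find i∈⋃ in lcpW-xK≈0-on-clique Ks-ind C∈Ks i∈C 0≤δ

    δ*AxK-mono : ∀ {δ δ′} → 0# ≤ δ → δ ≤ δ′ → ∀ Ks i → δ * AxK δ Ks i ≤ δ′ * AxK δ′ Ks i
    δ*AxK-mono {δ} {δ′} 0≤δ δ≤δ′ Ks i = begin
      δ * AxK δ Ks i                      ≈⟨ *-distribˡ-sumF δ (a*x δ) ⟩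
      sumF F (λ j → δ * a*x δ j)          ≈⟨ sumF-cong (λ j → x∙yz≈y∙xz δ (a j) (x δ j)) ⟩
      sumF F (λ j → a j * (δ * x δ j))
        ≤⟨ sumF-mono-≤ (λ j → *-monoʳ-≤-nonneg (0≤A i j) (δ*xK-mono 0≤δ δ≤δ′ Ks j)) ⟩
      sumF F (λ j → a j * (δ′ * x δ′ j))  ≈⟨ sumF-cong (λ j → x∙yz≈y∙xz (a j) δ′ (x δ′ j)) ⟩
      sumF F (λ j → δ′ * a*x δ′ j)        ≈⟨ sym (*-distribˡ-sumF δ′ (a*x δ′)) ⟩
      δ′ * AxK δ′ Ks i                    ∎
      where
      a : Fin N → Carrier
      a = A F G i
      x : Carrier → Fin N → Carrier
      x d = xK F G d Ks
      a*x : Carrier → Fin N → Carrier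
      a*x d j = a j * x d j

    lcpW-xK-mono-off-support : ∀ {δ δ′} → 0# ≤ δ → δ ≤ δ′ → ∀ Ks {i} → ¬ Any (i ∈_) Ks →
                               lcpW F G δ (xK F G δ Ks) i ≤ lcpW F G δ′ (xK F G δ′ Ks) i
    lcpW-xK-mono-off-support {δ} {δ′} 0≤δ δ≤δ′ Ks {i} i∉⋃ =
      +-monoˡ-≤ (- 1#) (+-mono-≤ (≤-reflexive x≈x′) (δ*AxK-mono 0≤δ δ≤δ′ Ks i))
      where
      x≈x′ : xK F G δ Ks i ≈ xK F G δ′ Ks i
      x≈x′ = reflexive (≡.trans (xK-∉ Ks i∉⋃) (≡.sym (xK-∉ Ks i∉⋃)))

    xK-support : ∀ {Ks} → AllPairs (DistinctIndependent G) Ks → ∀ {δ} → 0# ≤ δ →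
                 SupportIsUnion F G (xK F G δ Ks) Ks
    xK-support {Ks} Ks-DI {δ} 0≤δ i = mk⇔ to from
      where
      to : 0# < xK F G δ Ks i → Any (i ∈_) Ks
      to (_ , 0≉x) with covered? Ks i
      ... | yes i∈⋃ = i∈⋃
      ... | no  i∉⋃ = ⊥-elim (0≉x (sym (reflexive (xK-∉ Ks i∉⋃))))
      from : Any (i ∈_) Ks → 0# < xK F G δ Ks i
      from i∈⋃ = let C , C∈Ks , i∈C = find i∈⋃ in
        ≤-respʳ-≈ (reflexive (≡.sym (xK-∈ Ks-DI C∈Ks i∈C))) (proj₁ (0<cliqueWeight 0≤δ C)) ,
        λ 0≈x → proj₂ (0<cliqueWeight 0≤δ C) (trans 0≈x (reflexive (xK-∈ Ks-DI C∈Ks i∈C)))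

    xK-solvesLCP : ∀ {Ks} → PairwiseIndependentCliques G Ks → ∀ {δ δ′} → 0# ≤ δ → δ ≤ δ′ →
                   (∀ i → 0# ≤ lcpW F G δ (xK F G δ Ks) i) → SolvesLCP F G δ′ (xK F G δ′ Ks)
    xK-solvesLCP {Ks} Ks-ind {δ} {δ′} 0≤δ δ≤δ′ 0≤w = 0≤xK 0≤δ′ Ks , 0≤w′ , sumF-≈0 x′*w′≈0
      where
      0≤δ′ : 0# ≤ δ′
      0≤δ′ = ≤-trans 0≤δ δ≤δ′
      0≤w′ : ∀ i → 0# ≤ lcpW F G δ′ (xK F G δ′ Ks) i
      0≤w′ i with covered? Ks i
      ... | yes i∈⋃ = ≤-reflexive (sym (lcpW-xK≈0-on-support Ks-ind 0≤δ′ i∈⋃))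
      ... | no  i∉⋃ = ≤-trans (0≤w i) (lcpW-xK-mono-off-support 0≤δ δ≤δ′ Ks i∉⋃)
      x′*w′≈0 : ∀ i → xK F G δ′ Ks i * lcpW F G δ′ (xK F G δ′ Ks) i ≈ 0#
      x′*w′≈0 i with covered? Ks i
      ... | yes i∈⋃ = y≈0⇒x*y≈0 (lcpW-xK≈0-on-support Ks-ind 0≤δ′ i∈⋃)
      ... | no  i∉⋃ = x≈0⇒x*y≈0 (reflexive (xK-∉ Ks i∉⋃))

corollary4p7 : ∀ {c ℓ₁ ℓ₂} (F : OrderedField c ℓ₁ ℓ₂) {N : ℕ} (G : Graph N)
    (Ks : List (Subset N)) → PairwiseIndependentCliques G Ks →
    (δ : OrderedField.Carrier F) → OrderedField._<_ F (OrderedField.0# F) δ →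
    IsICS F G δ (xK F G δ Ks) →
    (δ′ : OrderedField.Carrier F) → OrderedField._≤_ F δ δ′ →
    OrderedField._<_ F δ′ (OrderedField.1# F) →
    Σ (Fin N → OrderedField.Carrier F)
      (λ x → IsICS F G δ′ x × SupportIsUnion F G x Ks)
corollary4p7 F G Ks Ks-ind _ (0≤δ , _) ((_ , 0≤w , _) , _) δ′ δ≤δ′ _ =
  xK F G δ′ Ks , (solves , Ks , Ks-ind , support) , support
  where
  open OrderedField F using (_≤_; 0#)
  0≤δ′ : 0# ≤ δ′
  0≤δ′ = IsTotalOrder.trans (OrderedField.isTotalOrder F) 0≤δ δ≤δ′
  solves : SolvesLCP F G δ′ (xK F G δ′ Ks)
  solves = xK-solvesLCP F G Ks-ind 0≤δ δ≤δ′ 0≤w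
  support : SupportIsUnion F G (xK F G δ′ Ks) Ks
  support = xK-support F G (proj₂ Ks-ind) 0≤δ′
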